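{- For $n \ge 1$, $$\dim_k\left(\frac{R}{I_W^{[\mathbf{n}]}}\right) = \sum_{r=1}^{n} r!\, s(n,r),$$ where $s(n,r)$ is the signless Stirling number of the first kind.
   Context: $k$ is a field, $R = k[x_1,\ldots,x_n]$, $\mathfrak{S}_n$ the permutations of $[n]$ in one-line notation. $\sigma$ avoids a pattern $\tau\in\mathfrak{S}_r$ if no subsequence of $\sigma(1)\cdots\sigma(n)$ has the same relative order as $\tau$. $W = \mathfrak{S}_n(132,312)$ is the set of permutations avoiding $132$ and $312$, and $I_W = \langle \prod_{i=1}^n x_i^{\sigma(i)} : \sigma \in W\rangle$ (the hypercubic ideal). For $\mathbf{a}\in\mathbb{N}^n$ and a monomial ideal $I$ whose minimal generators divide $\mathbf{x}^{\mathbf{a}}$, the Alexander dual is $I^{[\mathbf{a}]} = \bigcap_{\mathbf{x}^{\mathbf{b}}} \mathfrak{m}^{\mathbf{a}\setminus\mathbf{b}}$ over minimal generators $\mathbf{x}^{\mathbf{b}}$ of $I$, with $(\mathbf{a}\setminus\mathbf{b})_i = a_i+1-b_i$ if $b_i\ge1$, $0$ if $b_i=0$, and $\mathfrak{m}^{\mathbf{d}} = \langle x_i^{d_i} : d_i\ge 1\rangle$. $\mathbf{n} = (n,\ldots,n)$. $s(n,r)$ is the number of permutations of $[n]$ with exactly $r$ cycles. -}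

module Defs where

open import Data.Nat using (ℕ; zero; suc; _+_; _*_; _∸_; _≤_; _<_; _!)
open import Data.Nat.ListAction using (sum)
open import Data.Fin using (Fin; toℕ) renaming (_<_ to _<ᶠ_)
import Data.Fin as Fin
open import Data.Vec using (Vec; lookup; tabulate; replicate; zipWith)
open import Data.Vec.Relation.Binary.Pointwise.Inductive using (Pointwise)
open import Data.List using (List; length; map; upTo)
open import Data.List.Relation.Unary.Unique.Propositional using (Unique)
open import Data.List.Membership.Propositional using (_∈_)
open import Data.Product using (Σ; ∃; _×_)
open import Function.Bundles using (_⇔_)
open import Function.Definitions using (Injective)
open import Relation.Binary.PropositionalEquality using (_≡_)
open import Relation.Nullary using (¬_)

-- Monomials x^c in k[x_1..x_n] are identified with exponent vectors c : Vec ℕ n.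
-- A (monomial) ideal is described by its set of monomials, a predicate on exponent vectors.

-- Permutations of [n] in one-line notation: injective maps Fin n → Fin n
-- (value σ(i) ∈ [n] corresponds to toℕ (σ i) + 1).
IsPerm : (n : ℕ) → (Fin n → Fin n) → Set
IsPerm n σ = Injective _≡_ _≡_ σ

Contains : {n r : ℕ} → (Fin n → Fin n) → (Fin r → Fin r) → Set
Contains {n} {r} σ τ =
  Σ (Fin r → Fin n) λ f →
    (∀ a b → a <ᶠ b → f a <ᶠ f b) ×
    (∀ a b → (σ (f a) <ᶠ σ (f b)) ⇔ (τ a <ᶠ τ b))

Avoids : {n r : ℕ} → (Fin n → Fin n) → (Fin r → Fin r) → Set
Avoids σ τ = ¬ Contains σ τ

p132 : Fin 3 → Fin 3
p132 Fin.zero = Fin.zero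
p132 (Fin.suc Fin.zero) = Fin.suc (Fin.suc Fin.zero)
p132 (Fin.suc (Fin.suc _)) = Fin.suc Fin.zero

p312 : Fin 3 → Fin 3
p312 Fin.zero = Fin.suc (Fin.suc Fin.zero)
p312 (Fin.suc Fin.zero) = Fin.zero
p312 (Fin.suc (Fin.suc _)) = Fin.suc Fin.zero

InW : (n : ℕ) → (Fin n → Fin n) → Set
InW n σ = IsPerm n σ × Avoids σ p132 × Avoids σ p312

-- exponent vectors of the generators ∏ x_i^{σ(i)} of I_W, σ ∈ W
GenW : (n : ℕ) → Vec ℕ n → Set
GenW n b = Σ (Fin n → Fin n) λ σ → InW n σ × (b ≡ tabulate (λ i → suc (toℕ (σ i))))

_∣ₘ_ : {n : ℕ} → Vec ℕ n → Vec ℕ n → Set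
b ∣ₘ c = Pointwise _≤_ b c

MinGen : {n : ℕ} → (Vec ℕ n → Set) → Vec ℕ n → Set
MinGen G b = G b × (∀ b' → G b' → b' ∣ₘ b → b' ≡ b)

minusEntry : ℕ → ℕ → ℕ
minusEntry a zero = zero
minusEntry a (suc b) = suc a ∸ suc b

_∖ₑ_ : {n : ℕ} → Vec ℕ n → Vec ℕ n → Vec ℕ n
a ∖ₑ b = zipWith minusEntry a b

-- x^c ∈ m^d = ⟨ x_i^{d_i} : d_i ≥ 1 ⟩
InMd : {n : ℕ} → Vec ℕ n → Vec ℕ n → Set
InMd {n} d c = Σ (Fin n) λ i → (1 ≤ lookup d i) × (lookup d i ≤ lookup c i)

-- x^c ∈ I^[a] = ⋂_{x^b minimal generator of I} m^{a \ b}
InAlexDual : {n : ℕ} → Vec ℕ n → (Vec ℕ n → Set) → Vec ℕ n → Set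
InAlexDual a G c = ∀ b → MinGen G b → InMd (a ∖ₑ b) c

-- dim_k (R / J) = N for a monomial ideal J: the standard monomials (monomials not in J,
-- which form a k-basis of R/J) form a finite set of exactly N elements.
QuotDim : {n : ℕ} → (Vec ℕ n → Set) → ℕ → Set
QuotDim {n} J N =
  Σ (List (Vec ℕ n)) λ L → Unique L × (length L ≡ N) × (∀ c → (c ∈ L) ⇔ (¬ J c))

stirling : ℕ → ℕ → ℕ
stirling zero zero = 1
stirling zero (suc r) = 0
stirling (suc n) zero = 0
stirling (suc n) (suc r) = n * stirling n (suc r) + stirling n r

rhs : ℕ → ℕ
rhs n = sum (map (λ r → (suc r) ! * stirling n (suc r)) (upTo n))

-- A permutation avoids 132 and 312 exactly when each of its entries is a maximum or a minimum of
-- the entries up to it. Its last entry is then its largest or its smallest value, and deleting it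
-- leaves a permutation of the same kind on the remaining interval of values.
--
-- Distinct permutation vectors are incomparable, so every generator of I_W is minimal, and x^c lies
-- outside I_W^[n] iff some σ ∈ W, with values taken in {0, …, n−1}, has c_i + σ(i) < n for all i.
-- Allow a slack k (c_i + σ(i) < n + k) and look at the last coordinate: if σ puts its maximum
-- there, then c_last ≤ k and the slack of the other coordinates grows by one; if it puts its
-- minimum there, then c_last ≤ k + n − 1 and the slack is unchanged. A larger slack only helps, so
-- c_last alone decides which case to use, and the number N(n, k) of such c satisfies N(0, k) = 1
-- and N(n+1, k) = (k+1) N(n, k+1) + n N(n, k). With s(n+1, r) = n s(n, r) + s(n, r−1), induction
-- on n gives N(n, k) k! = Σ_r s(n, r) (k+r)!, which at k = 0 is Σ_r r! s(n, r), the term r = 0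
-- vanishing for n ≥ 1.
module Submission where

open import Defs
open import Data.Empty using (⊥)
open import Data.Fin using (Fin; toℕ; fromℕ; fromℕ<; inject₁; punchOut)
  renaming (zero to fzero; suc to fsuc; _<_ to _<ᶠ_; _≤_ to _≤ᶠ_)
import Data.Fin.Induction as Finᵢ
import Data.Fin.Properties as Finₚ
open import Data.List using (List; [_]; _++_; length; upTo; applyUpTo; cartesianProductWith)
import Data.List as List
open import Data.List.Membership.Propositional using (_∈_)
open import Data.List.Membership.Propositional.Properties
  using ( ∈-++⁺ˡ; ∈-++⁺ʳ; ∈-++⁻; ∈-upTo⁺; ∈-upTo⁻; ∈-applyUpTo⁺; ∈-applyUpTo⁻
        ; ∈-cartesianProductWith⁺; ∈-cartesianProductWith⁻)
import Data.List.Properties as Listₚ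
import Data.List.Relation.Unary.All as All
import Data.List.Relation.Unary.AllPairs as AllPairs
open import Data.List.Relation.Unary.Any using (here)
open import Data.List.Relation.Unary.Unique.Propositional using (Unique)
import Data.List.Relation.Unary.Unique.Propositional.Properties as Unique
open import Data.Nat using (ℕ; zero; suc; _+_; _*_; _∸_; _≤_; _<_; _!; z≤n; s≤s; s≤s⁻¹; z<s)
import Data.Nat.ListAction as ListAction
open import Data.Nat.Properties
open import Algebra.Properties.Semiring.Sum +-*-semiring
  using (sum-syntax; ∑-distrib-+; *-distribˡ-sum; sum-cong-≗; sum-replicate-zero)
open import Data.Nat.Tactic.RingSolver using (solve-∀)
open import Data.Product using (∃; _×_; _,_; proj₁; proj₂)
open import Data.Sum using (_⊎_; inj₁; inj₂)
open import Data.Unit using (⊤; tt)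
open import Data.Vec using (Vec; []; _∷_; _∷ʳ_; lookup; tabulate; replicate; initLast)
open import Data.Vec.Functional using (init; last)
import Data.Vec.Properties as Vecₚ
import Data.Vec.Relation.Binary.Pointwise.Inductive as Pointwise
open import Function using (_∘_; id; _⇔_; mk⇔; Equivalence)
open import Function.Definitions using (Injective)
import Induction.WellFounded as WF
open import Level using (0ℓ)
open import Relation.Binary.Definitions using (tri<; tri≈; tri>)
open import Relation.Binary.PropositionalEquality
  using (_≡_; _≢_; _≗_; refl; sym; trans; cong; cong₂; subst; subst₂; module ≡-Reasoning)
open import Relation.Nullary using (¬_; Dec; yes; no; contradiction; _×-dec_; _⊎-dec_)
open import Relation.Nullary.Decidable using (decidable-stable)

fromℕ⊎inject₁ : ∀ {m} (i : Fin (suc m)) → i ≡ fromℕ m ⊎ ∃ λ j → i ≡ inject₁ j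
fromℕ⊎inject₁ {zero}  fzero    = inj₁ refl
fromℕ⊎inject₁ {suc m} fzero    = inj₂ (fzero , refl)
fromℕ⊎inject₁ {suc m} (fsuc i) with fromℕ⊎inject₁ i
... | inj₁ refl       = inj₁ refl
... | inj₂ (j , refl) = inj₂ (fsuc j , refl)

∀-snoc : ∀ {m} {P : Fin (suc m) → Set} → P (fromℕ m) → (∀ i → P (inject₁ i)) → ∀ i → P i
∀-snoc P-last P-init i with fromℕ⊎inject₁ i
... | inj₁ refl       = P-last
... | inj₂ (j , refl) = P-init j

inject₁<fromℕ : ∀ {m} (i : Fin m) → inject₁ i <ᶠ fromℕ m
inject₁<fromℕ {m} i = subst (toℕ (inject₁ i) <_) (sym (Finₚ.toℕ-fromℕ m)) (Finₚ.inject₁ℕ< i)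

inject₁-mono-< : ∀ {m} {i j : Fin m} → i <ᶠ j → inject₁ i <ᶠ inject₁ j
inject₁-mono-< {i = i} {j} = subst₂ _<_ (sym (Finₚ.toℕ-inject₁ i)) (sym (Finₚ.toℕ-inject₁ j))

<fromℕ⇒inject₁ : ∀ {m} {i : Fin (suc m)} → i <ᶠ fromℕ m → ∃ λ i′ → i ≡ inject₁ i′
<fromℕ⇒inject₁ {i = i} i<last with fromℕ⊎inject₁ i
... | inj₁ refl   = contradiction i<last (n≮n _)
... | inj₂ i≡inj = i≡inj

<inject₁⇒inject₁ : ∀ {m} {i : Fin (suc m)} {j : Fin m} → i <ᶠ inject₁ j →
                   ∃ λ i′ → i ≡ inject₁ i′ × i′ <ᶠ j
<inject₁⇒inject₁ {i = i} {j} i<j with fromℕ⊎inject₁ i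
... | inj₁ refl        = contradiction (inject₁<fromℕ j) (<-asym i<j)
... | inj₂ (i′ , refl) = i′ , refl , subst₂ _<_ (Finₚ.toℕ-inject₁ i′) (Finₚ.toℕ-inject₁ j) i<j

module _ {A : Set} where

  lookup-∷ʳ-inject₁ : ∀ {m} (v : Vec A m) x i → lookup (v ∷ʳ x) (inject₁ i) ≡ lookup v i
  lookup-∷ʳ-inject₁ (y ∷ v) x fzero    = refl
  lookup-∷ʳ-inject₁ (y ∷ v) x (fsuc i) = lookup-∷ʳ-inject₁ v x i

  lookup-∷ʳ-fromℕ : ∀ {m} (v : Vec A m) x → lookup (v ∷ʳ x) (fromℕ m) ≡ x
  lookup-∷ʳ-fromℕ []      x = refl
  lookup-∷ʳ-fromℕ (y ∷ v) x = lookup-∷ʳ-fromℕ v x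

injective⇒surjective : ∀ {n} {σ : Fin n → Fin n} → Injective _≡_ _≡_ σ → ∀ v → ∃ λ i → σ i ≡ v
injective⇒surjective {suc n} {σ} σ-inj v with Finₚ.any? (λ i → σ i Finₚ.≟ v)
... | yes hit  = hit
... | no  miss = contradiction (Finₚ.injective⇒≤ punched-inj) 1+n≰n
  where
  v≢σ : ∀ i → v ≢ σ i
  v≢σ i v≡σi = miss (i , sym v≡σi)
  punched : Fin (suc n) → Fin n
  punched i = punchOut (v≢σ i)
  punched-inj : Injective _≡_ _≡_ punched
  punched-inj {i} {j} eq = σ-inj (Finₚ.punchOut-injective (v≢σ i) (v≢σ j) eq)

injective-deflationary⇒≗id : ∀ {n} {h : Fin n → Fin n} → Injective _≡_ _≡_ h →
                              (∀ v → h v ≤ᶠ v) → ∀ v → h v ≡ v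
injective-deflationary⇒≗id {h = h} h-inj h≤ = WF.All.wfRec Finᵢ.<-wellFounded 0ℓ (λ v → h v ≡ v) step
  where
  step : ∀ v → (∀ {w} → w <ᶠ v → h w ≡ w) → h v ≡ v
  step v rec with h v Finₚ.≟ v
  ... | yes hv≡v = hv≡v
  ... | no  hv≢v = contradiction (h-inj (rec (Finₚ.≤∧≢⇒< (h≤ v) hv≢v))) hv≢v

injective-≤⇒≗ : ∀ {n} {σ τ : Fin n → Fin n} → Injective _≡_ _≡_ σ → Injective _≡_ _≡_ τ →
                (∀ i → σ i ≤ᶠ τ i) → ∀ i → σ i ≡ τ i
injective-≤⇒≗ {σ = σ} {τ} σ-inj τ-inj σ≤τ i = begin
  σ i           ≡⟨ cong σ (τ-inj (τ∘τ⁻¹ (τ i))) ⟨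
  σ (τ⁻¹ (τ i)) ≡⟨ injective-deflationary⇒≗id σ∘τ⁻¹-inj σ∘τ⁻¹≤id (τ i) ⟩
  τ i           ∎
  where
  open ≡-Reasoning
  τ⁻¹ : Fin _ → Fin _
  τ⁻¹ v = proj₁ (injective⇒surjective τ-inj v)
  τ∘τ⁻¹ : ∀ v → τ (τ⁻¹ v) ≡ v
  τ∘τ⁻¹ v = proj₂ (injective⇒surjective τ-inj v)
  σ∘τ⁻¹-inj : Injective _≡_ _≡_ (σ ∘ τ⁻¹)
  σ∘τ⁻¹-inj {v} {w} eq = trans (sym (τ∘τ⁻¹ v)) (trans (cong τ (σ-inj eq)) (τ∘τ⁻¹ w))
  σ∘τ⁻¹≤id : ∀ v → σ (τ⁻¹ v) ≤ᶠ v
  σ∘τ⁻¹≤id v = subst (σ (τ⁻¹ v) ≤ᶠ_) (τ∘τ⁻¹ v) (σ≤τ (τ⁻¹ v))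

injective-init : ∀ {m} {f : Fin (suc m) → ℕ} → Injective _≡_ _≡_ f → Injective _≡_ _≡_ (init f)
injective-init f-inj = Finₚ.inject₁-injective ∘ f-inj

injective-snoc : ∀ {m} {f : Fin (suc m) → ℕ} → Injective _≡_ _≡_ (init f) →
                 (∀ i → init f i ≢ last f) → Injective _≡_ _≡_ f
injective-snoc init-inj fresh {i} {j} fi≡fj with fromℕ⊎inject₁ i | fromℕ⊎inject₁ j
... | inj₁ refl        | inj₁ refl        = refl
... | inj₁ refl        | inj₂ (j′ , refl) = contradiction (sym fi≡fj) (fresh j′)
... | inj₂ (i′ , refl) | inj₁ refl        = contradiction fi≡fj (fresh i′)
... | inj₂ (i′ , refl) | inj₂ (j′ , refl) = cong inject₁ (init-inj fi≡fj)

Extremal : ∀ {m} → (Fin m → ℕ) → Set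
Extremal f = ∀ a b j → a <ᶠ j → b <ᶠ j → f a < f j → f j < f b → ⊥

data LastExtreme {m} (f : Fin (suc m) → ℕ) : Set where
  last-max : (∀ i → init f i < last f) → LastExtreme f
  last-min : (∀ i → last f < init f i) → LastExtreme f

extremal-init : ∀ {m} {f : Fin (suc m) → ℕ} → Extremal f → Extremal (init f)
extremal-init f-ext a b j a<j b<j =
  f-ext (inject₁ a) (inject₁ b) (inject₁ j) (inject₁-mono-< a<j) (inject₁-mono-< b<j)

lastExtreme : ∀ {m} {f : Fin (suc m) → ℕ} → Injective _≡_ _≡_ f → Extremal f → LastExtreme f
lastExtreme {m} {f} f-inj f-ext with Finₚ.any? (λ i → init f i <? last f)
... | yes (a , fa<last) = last-max below
  where
  below : ∀ i → init f i < last f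
  below i with <-cmp (init f i) (last f)
  ... | tri< fi<last _ _ = fi<last
  ... | tri≈ _ fi≡last _ = contradiction (sym (f-inj fi≡last)) Finₚ.fromℕ≢inject₁
  ... | tri> _ _ last<fi = contradiction last<fi
    (f-ext (inject₁ a) (inject₁ i) (fromℕ m) (inject₁<fromℕ a) (inject₁<fromℕ i) fa<last)
... | no none-below = last-min above
  where
  above : ∀ i → last f < init f i
  above i with <-cmp (init f i) (last f)
  ... | tri< fi<last _ _ = contradiction (i , fi<last) none-below
  ... | tri≈ _ fi≡last _ = contradiction (sym (f-inj fi≡last)) Finₚ.fromℕ≢inject₁
  ... | tri> _ _ last<fi = last<fi

extremal-snoc : ∀ {m} {f : Fin (suc m) → ℕ} → Extremal (init f) → LastExtreme f → Extremal f
extremal-snoc init-ext extreme a b j a<j b<j fa<fj fj<fb with fromℕ⊎inject₁ j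
... | inj₁ refl with <fromℕ⇒inject₁ a<j | <fromℕ⇒inject₁ b<j | extreme
...   | _ , refl | _ , refl | last-max below = <-asym fj<fb (below _)
...   | _ , refl | _ , refl | last-min above = <-asym fa<fj (above _)
extremal-snoc init-ext extreme a b j a<j b<j fa<fj fj<fb | inj₂ (j′ , refl)
  with <inject₁⇒inject₁ a<j | <inject₁⇒inject₁ b<j
... | a′ , refl , a′<j′ | b′ , refl , b′<j′ = init-ext a′ b′ j′ a′<j′ b′<j′ fa<fj fj<fb

triple : ∀ {n} → Fin n → Fin n → Fin n → Fin 3 → Fin n
triple a b c fzero           = a
triple a b c (fsuc fzero)    = b
triple a b c (fsuc (fsuc _)) = c

triple-increasing : ∀ {n} {a b c : Fin n} → a <ᶠ b → b <ᶠ c →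
                    ∀ u v → u <ᶠ v → triple a b c u <ᶠ triple a b c v
triple-increasing a<b b<c fzero               (fsuc fzero)        _ = a<b
triple-increasing a<b b<c fzero               (fsuc (fsuc fzero)) _ = <-trans a<b b<c
triple-increasing a<b b<c (fsuc fzero)        (fsuc (fsuc fzero)) _ = b<c
triple-increasing a<b b<c (fsuc fzero)        (fsuc fzero)        (s≤s ())
triple-increasing a<b b<c (fsuc (fsuc fzero)) (fsuc fzero)        (s≤s ())
triple-increasing a<b b<c (fsuc (fsuc fzero)) (fsuc (fsuc fzero)) (s≤s (s≤s ()))

both : ∀ {A B : Set} → A → B → A ⇔ B
both a b = mk⇔ (λ _ → b) (λ _ → a)

neither : ∀ {A B : Set} → ¬ A → ¬ B → A ⇔ B
neither ¬a ¬b = mk⇔ (λ a → contradiction a ¬a) (λ b → contradiction b ¬b)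

module _ {n} (σ : Fin n → Fin n) where

  contains-132 : ∀ {a b c} → a <ᶠ b → b <ᶠ c → σ a <ᶠ σ c → σ c <ᶠ σ b → Contains σ p132
  contains-132 {a} {b} {c} a<b b<c x<z z<y = triple a b c , triple-increasing a<b b<c , same-order
    where
    x<y = <-trans x<z z<y
    same-order : ∀ u v → (σ (triple a b c u) <ᶠ σ (triple a b c v)) ⇔ (p132 u <ᶠ p132 v)
    same-order fzero               fzero               = neither (n≮n _) (n≮n _)
    same-order fzero               (fsuc fzero)        = both x<y (s≤s z≤n)
    same-order fzero               (fsuc (fsuc fzero)) = both x<z (s≤s z≤n)
    same-order (fsuc fzero)        fzero               = neither (<-asym x<y) λ ()
    same-order (fsuc fzero)        (fsuc fzero)        = neither (n≮n _) (n≮n _)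
    same-order (fsuc fzero)        (fsuc (fsuc fzero)) = neither (<-asym z<y) λ { (s≤s ()) }
    same-order (fsuc (fsuc fzero)) fzero               = neither (<-asym x<z) λ ()
    same-order (fsuc (fsuc fzero)) (fsuc fzero)        = both z<y (s≤s (s≤s z≤n))
    same-order (fsuc (fsuc fzero)) (fsuc (fsuc fzero)) = neither (n≮n _) (n≮n _)

  contains-312 : ∀ {a b c} → a <ᶠ b → b <ᶠ c → σ b <ᶠ σ c → σ c <ᶠ σ a → Contains σ p312
  contains-312 {a} {b} {c} a<b b<c y<z z<x = triple a b c , triple-increasing a<b b<c , same-order
    where
    y<x = <-trans y<z z<x
    same-order : ∀ u v → (σ (triple a b c u) <ᶠ σ (triple a b c v)) ⇔ (p312 u <ᶠ p312 v)
    same-order fzero               fzero               = neither (n≮n _) (n≮n _)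
    same-order fzero               (fsuc fzero)        = neither (<-asym y<x) λ ()
    same-order fzero               (fsuc (fsuc fzero)) = neither (<-asym z<x) λ { (s≤s ()) }
    same-order (fsuc fzero)        fzero               = both y<x (s≤s z≤n)
    same-order (fsuc fzero)        (fsuc fzero)        = neither (n≮n _) (n≮n _)
    same-order (fsuc fzero)        (fsuc (fsuc fzero)) = both y<z (s≤s z≤n)
    same-order (fsuc (fsuc fzero)) fzero               = both z<x (s≤s (s≤s z≤n))
    same-order (fsuc (fsuc fzero)) (fsuc fzero)        = neither (<-asym y<z) λ ()
    same-order (fsuc (fsuc fzero)) (fsuc (fsuc fzero)) = neither (n≮n _) (n≮n _)

  private
    0<1 : fzero {2} <ᶠ fsuc {2} fzero
    0<1 = s≤s z≤n
    0<2 : fzero {2} <ᶠ fsuc {2} (fsuc fzero)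
    0<2 = s≤s z≤n
    1<2 : fsuc {2} fzero <ᶠ fsuc {2} (fsuc fzero)
    1<2 = s≤s (s≤s z≤n)

  extremal⇒avoids-132 : Extremal (toℕ ∘ σ) → Avoids σ p132
  extremal⇒avoids-132 σ-ext (e , e-inc , same-order) =
    σ-ext (e fzero) (e (fsuc fzero)) (e (fsuc (fsuc fzero))) (e-inc _ _ 0<2) (e-inc _ _ 1<2)
      (Equivalence.from (same-order _ _) 0<1) (Equivalence.from (same-order _ (fsuc fzero)) 1<2)

  extremal⇒avoids-312 : Extremal (toℕ ∘ σ) → Avoids σ p312
  extremal⇒avoids-312 σ-ext (e , e-inc , same-order) =
    σ-ext (e (fsuc fzero)) (e fzero) (e (fsuc (fsuc fzero))) (e-inc _ _ 1<2) (e-inc _ _ 0<2)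
      (Equivalence.from (same-order (fsuc fzero) _) 0<1) (Equivalence.from (same-order _ fzero) 1<2)

  avoids⇒extremal : Avoids σ p132 → Avoids σ p312 → Extremal (toℕ ∘ σ)
  avoids⇒extremal avoids-132 avoids-312 a b j a<j b<j σa<σj σj<σb with Finₚ.<-cmp a b
  ... | tri< a<b _ _  = avoids-132 (contains-132 a<b b<j σa<σj σj<σb)
  ... | tri≈ _ refl _ = <-asym σa<σj σj<σb
  ... | tri> _ _ b<a  = avoids-312 (contains-312 b<a a<j σa<σj σj<σb)

injective-interval⇒≤ : ∀ {m l n} {f : Fin m → ℕ} → Injective _≡_ _≡_ f →
                       (∀ i → l ≤ f i) → (∀ i → f i < l + n) → m ≤ n
injective-interval⇒≤ {m} {l} {n} {f} f-inj l≤f f<l+n = Finₚ.injective⇒≤ shifted-inj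
  where
  shifted< : ∀ i → f i ∸ l < n
  shifted< i = subst (f i ∸ l <_) (m+n∸m≡n l n) (∸-monoˡ-< (f<l+n i) (l≤f i))
  shifted : Fin m → Fin n
  shifted i = fromℕ< (shifted< i)
  shifted-inj : Injective _≡_ _≡_ shifted
  shifted-inj {i} {j} eq = f-inj (begin
    f i         ≡⟨ m∸n+n≡m (l≤f i) ⟨
    f i ∸ l + l ≡⟨ cong (_+ l) (Finₚ.fromℕ<-injective _ _ (shifted< i) (shifted< j) eq) ⟩
    f j ∸ l + l ≡⟨ m∸n+n≡m (l≤f j) ⟩
    f j         ∎)
    where open ≡-Reasoning

record IsWPerm (l m : ℕ) (f : Fin m → ℕ) : Set where
  field
    lower     : ∀ i → l ≤ f i
    upper     : ∀ i → f i < l + m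
    injective : Injective _≡_ _≡_ f
    extremal  : Extremal f

isWPerm-cong : ∀ {l m} {f g : Fin m → ℕ} → f ≗ g → IsWPerm l m f → IsWPerm l m g
isWPerm-cong {l} {m} f≗g f-perm = record
  { lower     = λ i → subst (l ≤_) (f≗g i) (lower i)
  ; upper     = λ i → subst (_< l + m) (f≗g i) (upper i)
  ; injective = λ {i} {j} gi≡gj → injective (trans (f≗g i) (trans gi≡gj (sym (f≗g j))))
  ; extremal  = λ a b j a<j b<j ga<gj gj<gb → extremal a b j a<j b<j
      (subst₂ _<_ (sym (f≗g a)) (sym (f≗g j)) ga<gj) (subst₂ _<_ (sym (f≗g j)) (sym (f≗g b)) gj<gb)
  }
  where open IsWPerm f-perm

isWPerm-empty : ∀ l (f : Fin 0 → ℕ) → IsWPerm l 0 f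
isWPerm-empty l f = record { lower = λ () ; upper = λ () ; injective = λ { {()} } ; extremal = λ () }

isWPerm-snoc-max : ∀ {l m} {f : Fin (suc m) → ℕ} → IsWPerm l m (init f) → last f ≡ l + m →
                   IsWPerm l (suc m) f
isWPerm-snoc-max {l} {m} {f} init-perm last≡l+m = record
  { lower     = ∀-snoc (subst (l ≤_) (sym last≡l+m) (m≤m+n l m)) lower
  ; upper     = ∀-snoc (subst (_< l + suc m) (sym last≡l+m) l+m<l+1+m) (λ i → <-trans (upper i) l+m<l+1+m)
  ; injective = injective-snoc injective (λ i → <⇒≢ (below i))
  ; extremal  = extremal-snoc extremal (last-max below)
  }
  where
  open IsWPerm init-perm
  l+m<l+1+m : l + m < l + suc m
  l+m<l+1+m = +-monoʳ-< l (n<1+n m)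
  below : ∀ i → init f i < last f
  below i = subst (init f i <_) (sym last≡l+m) (upper i)

isWPerm-snoc-min : ∀ {l m} {f : Fin (suc m) → ℕ} → IsWPerm (suc l) m (init f) → last f ≡ l →
                   IsWPerm l (suc m) f
isWPerm-snoc-min {l} {m} {f} init-perm last≡l = record
  { lower     = ∀-snoc (≤-reflexive (sym last≡l)) (λ i → <⇒≤ (lower i))
  ; upper     = ∀-snoc (subst (_< l + suc m) (sym last≡l) (m<m+n l z<s))
                       (λ i → subst (init f i <_) (sym (+-suc l m)) (upper i))
  ; injective = injective-snoc injective (λ i → >⇒≢ (above i))
  ; extremal  = extremal-snoc extremal (last-min above)
  }
  where
  open IsWPerm init-perm
  above : ∀ i → last f < init f i
  above i = subst (_< init f i) (sym last≡l) (lower i)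

isWPerm-∷ʳ-max : ∀ {l m} (v : Vec ℕ m) → IsWPerm l m (lookup v) →
                 IsWPerm l (suc m) (lookup (v ∷ʳ (l + m)))
isWPerm-∷ʳ-max v perm =
  isWPerm-snoc-max (isWPerm-cong (sym ∘ lookup-∷ʳ-inject₁ v _) perm) (lookup-∷ʳ-fromℕ v _)

isWPerm-∷ʳ-min : ∀ {l m} (v : Vec ℕ m) → IsWPerm (suc l) m (lookup v) →
                 IsWPerm l (suc m) (lookup (v ∷ʳ l))
isWPerm-∷ʳ-min v perm =
  isWPerm-snoc-min (isWPerm-cong (sym ∘ lookup-∷ʳ-inject₁ v _) perm) (lookup-∷ʳ-fromℕ v _)

isWPerm-init-max : ∀ {l m} {f : Fin (suc m) → ℕ} → IsWPerm l (suc m) f → (∀ i → init f i < last f) →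
                   IsWPerm l m (init f) × last f ≡ l + m
isWPerm-init-max {l} {m} {f} f-perm below = init-perm , last≡l+m
  where
  open IsWPerm f-perm
  last≤l+m : last f ≤ l + m
  last≤l+m = s≤s⁻¹ (subst (last f <_) (+-suc l m) (upper (fromℕ m)))
  l+m≤last : l + m ≤ last f
  l+m≤last = ≮⇒≥ λ last<l+m →
    1+n≰n (injective-interval⇒≤ injective lower (∀-snoc last<l+m (λ i → <-trans (below i) last<l+m)))
  last≡l+m : last f ≡ l + m
  last≡l+m = ≤-antisym last≤l+m l+m≤last
  init-perm : IsWPerm l m (init f)
  init-perm = record
    { lower     = lower ∘ inject₁
    ; upper     = λ i → subst (init f i <_) last≡l+m (below i)
    ; injective = injective-init injective
    ; extremal  = extremal-init extremal
    }

isWPerm-init-min : ∀ {l m} {f : Fin (suc m) → ℕ} → IsWPerm l (suc m) f → (∀ i → last f < init f i) →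
                   IsWPerm (suc l) m (init f)
isWPerm-init-min {l} {m} {f} f-perm above = record
  { lower     = λ i → ≤-<-trans (lower (fromℕ m)) (above i)
  ; upper     = λ i → subst (init f i <_) (+-suc l m) (upper (inject₁ i))
  ; injective = injective-init injective
  ; extremal  = extremal-init extremal
  }
  where open IsWPerm f-perm

inW⇒isWPerm : ∀ {n} {σ : Fin n → Fin n} → InW n σ → IsWPerm 0 n (toℕ ∘ σ)
inW⇒isWPerm {σ = σ} (σ-inj , avoids-132 , avoids-312) = record
  { lower     = λ _ → z≤n
  ; upper     = Finₚ.toℕ<n ∘ σ
  ; injective = σ-inj ∘ Finₚ.toℕ-injective
  ; extremal  = avoids⇒extremal σ avoids-132 avoids-312
  }

isWPerm⇒inW : ∀ {n} {σ : Fin n → Fin n} → IsWPerm 0 n (toℕ ∘ σ) → InW n σ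
isWPerm⇒inW {σ = σ} perm =
  injective ∘ cong toℕ , extremal⇒avoids-132 σ extremal , extremal⇒avoids-312 σ extremal
  where open IsWPerm perm

-- Some W-permutation f of [0, m) has g i + f i < k + m for all i; its last entry is its maximum
-- (first case) or, when last g exceeds k, its minimum (second case).
Standard : (m k : ℕ) → (Fin m → ℕ) → Set
Standard zero    k g = ⊤
Standard (suc m) k g = (last g < suc k × Standard m (suc k) (init g))
                     ⊎ (k < last g × last g < suc k + m × Standard m k (init g))

standard? : ∀ m k g → Dec (Standard m k g)
standard? zero    k g = yes tt
standard? (suc m) k g = (last g <? suc k ×-dec standard? m (suc k) (init g))
                 ⊎-dec (k <? last g ×-dec last g <? suc k + m ×-dec standard? m k (init g))

standard-cong : ∀ m k {g h : Fin m → ℕ} → g ≗ h → Standard m k g → Standard m k h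
standard-cong zero    k g≗h _ = tt
standard-cong (suc m) k g≗h (inj₁ (g<1+k , rest)) =
  inj₁ (subst (_< suc k) (g≗h _) g<1+k , standard-cong m (suc k) (g≗h ∘ inject₁) rest)
standard-cong (suc m) k g≗h (inj₂ (k<g , g<1+k+m , rest)) =
  inj₂ ( subst (k <_) (g≗h _) k<g , subst (_< suc k + m) (g≗h _) g<1+k+m
       , standard-cong m k (g≗h ∘ inject₁) rest)

mutual
  standard-suc : ∀ m k {g} → Standard m k g → Standard m (suc k) g
  standard-suc zero    k _ = tt
  standard-suc (suc m) k (inj₁ (g<1+k , rest)) = inj₁ (m<n⇒m<1+n g<1+k , standard-suc m (suc k) rest)
  standard-suc (suc m) k {g} (inj₂ (_ , g<1+k+m , rest)) =
    standard-snoc m (suc k) {g} (m<n⇒m<1+n g<1+k+m) (standard-suc m k rest)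

  standard-snoc : ∀ m k {g} → last g < suc k + m → Standard m k (init g) → Standard (suc m) k g
  standard-snoc m k {g} g<1+k+m rest with last g <? suc k
  ... | yes g<1+k = inj₁ (g<1+k , standard-suc m k rest)
  ... | no  g≮1+k = inj₂ (≮⇒≥ g≮1+k , g<1+k+m , rest)

Below : ∀ {m} → ℕ → (Fin m → ℕ) → (Fin m → ℕ) → Set
Below N g f = ∀ i → g i + f i < N

below-∷ʳ : ∀ {m N} {g : Fin (suc m) → ℕ} (v : Vec ℕ m) {x} →
           Below N (init g) (lookup v) → last g + x < N → Below N g (lookup (v ∷ʳ x))
below-∷ʳ {N = N} {g} v {x} init-below last-below = ∀-snoc
  (subst (λ y → last g + y < N) (sym (lookup-∷ʳ-fromℕ v x)) last-below)
  (λ i → subst (λ y → init g i + y < N) (sym (lookup-∷ʳ-inject₁ v x i)) (init-below i))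

slack-max : ∀ k l m → suc k + (l + m) ≡ k + (l + suc m)
slack-max = solve-∀

slack-min : ∀ k l m → suc k + m + l ≡ k + (l + suc m)
slack-min = solve-∀

slack-min-init : ∀ k l m → k + (suc l + m) ≡ k + (l + suc m)
slack-min-init k l m = cong (k +_) (sym (+-suc l m))

standard⇒isWPerm : ∀ m k l {g} → Standard m k g →
                   ∃ λ (v : Vec ℕ m) → IsWPerm l m (lookup v) × Below (k + (l + m)) g (lookup v)
standard⇒isWPerm zero    k l _ = [] , isWPerm-empty l _ , λ ()
standard⇒isWPerm (suc m) k l {g} (inj₁ (g<1+k , rest)) with standard⇒isWPerm m (suc k) l rest
... | v , perm , below = v ∷ʳ (l + m) , isWPerm-∷ʳ-max v perm , below-∷ʳ v init-below last-below
  where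
  init-below : Below (k + (l + suc m)) (init g) (lookup v)
  init-below = subst (λ N → Below N (init g) (lookup v)) (slack-max k l m) below
  last-below : last g + (l + m) < k + (l + suc m)
  last-below = subst (last g + (l + m) <_) (slack-max k l m) (+-monoˡ-< (l + m) g<1+k)
standard⇒isWPerm (suc m) k l {g} (inj₂ (_ , g<1+k+m , rest)) with standard⇒isWPerm m k (suc l) rest
... | v , perm , below = v ∷ʳ l , isWPerm-∷ʳ-min v perm , below-∷ʳ v init-below last-below
  where
  init-below : Below (k + (l + suc m)) (init g) (lookup v)
  init-below = subst (λ N → Below N (init g) (lookup v)) (slack-min-init k l m) below
  last-below : last g + l < k + (l + suc m)
  last-below = subst (last g + l <_) (slack-min k l m) (+-monoˡ-< l g<1+k+m)

isWPerm⇒standard : ∀ m k l {g f} → IsWPerm l m f → Below (k + (l + m)) g f → Standard m k g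
isWPerm⇒standard zero    k l _ _ = tt
isWPerm⇒standard (suc m) k l {g} {f} perm below with lastExtreme (IsWPerm.injective perm) (IsWPerm.extremal perm)
... | last-max init<last = inj₁ (g<1+k , isWPerm⇒standard m (suc k) l init-perm init-below)
  where
  init-perm : IsWPerm l m (init f)
  init-perm = proj₁ (isWPerm-init-max perm init<last)
  last≡l+m : last f ≡ l + m
  last≡l+m = proj₂ (isWPerm-init-max perm init<last)
  init-below : Below (suc k + (l + m)) (init g) (init f)
  init-below = subst (λ N → Below N (init g) (init f)) (sym (slack-max k l m)) (below ∘ inject₁)
  g<1+k : last g < suc k
  g<1+k = +-cancelʳ-< (l + m) (last g) (suc k)
    (subst₂ (λ y N → last g + y < N) last≡l+m (sym (slack-max k l m)) (below (fromℕ m)))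
... | last-min last<init = standard-snoc m k {g} g<1+k+m (isWPerm⇒standard m k (suc l) init-perm init-below)
  where
  init-perm : IsWPerm (suc l) m (init f)
  init-perm = isWPerm-init-min perm last<init
  init-below : Below (k + (suc l + m)) (init g) (init f)
  init-below = subst (λ N → Below N (init g) (init f)) (sym (slack-min-init k l m)) (below ∘ inject₁)
  g<1+k+m : last g < suc k + m
  g<1+k+m = +-cancelʳ-< l (last g) (suc k + m) (subst (last g + l <_) (sym (slack-min k l m))
    (≤-<-trans (+-monoʳ-≤ (last g) (IsWPerm.lower perm (fromℕ m))) (below (fromℕ m))))

standard⇔below-W : ∀ n (g : Fin n → ℕ) → Standard n 0 g ⇔ (∃ λ σ → InW n σ × Below n g (toℕ ∘ σ))
standard⇔below-W n g = mk⇔ to from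
  where
  to : Standard n 0 g → ∃ λ σ → InW n σ × Below n g (toℕ ∘ σ)
  to std with standard⇒isWPerm n 0 0 std
  ... | v , perm , below = σ , isWPerm⇒inW (isWPerm-cong (sym ∘ toℕ∘σ) perm) , below′
    where
    σ : Fin n → Fin n
    σ i = fromℕ< (IsWPerm.upper perm i)
    toℕ∘σ : ∀ i → toℕ (σ i) ≡ lookup v i
    toℕ∘σ i = Finₚ.toℕ-fromℕ< (IsWPerm.upper perm i)
    below′ : Below n g (toℕ ∘ σ)
    below′ i = subst (λ y → g i + y < n) (sym (toℕ∘σ i)) (below i)
  from : (∃ λ σ → InW n σ × Below n g (toℕ ∘ σ)) → Standard n 0 g
  from (σ , σ∈W , below) = isWPerm⇒standard n 0 0 (inW⇒isWPerm σ∈W) below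

∈-interval⁺ : ∀ {a m x} → a ≤ x → x < a + m → x ∈ applyUpTo (a +_) m
∈-interval⁺ {a} {m} {x} a≤x x<a+m = subst (_∈ applyUpTo (a +_) m) (m+[n∸m]≡n a≤x)
  (∈-applyUpTo⁺ (a +_) (subst (x ∸ a <_) (m+n∸m≡n a m) (∸-monoˡ-< x<a+m a≤x)))

∈-interval⁻ : ∀ {a m x} → x ∈ applyUpTo (a +_) m → a ≤ x × x < a + m
∈-interval⁻ {a} x∈ with ∈-applyUpTo⁻ (a +_) x∈
... | i , i<m , refl = m≤m+n a i , +-monoʳ-< a i<m

length-cartesianProductWith : ∀ {A B C : Set} (f : A → B → C) xs ys →
                              length (cartesianProductWith f xs ys) ≡ length xs * length ys
length-cartesianProductWith f List.[]       ys = refl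
length-cartesianProductWith f (x List.∷ xs) ys = begin
  length (List.map (f x) ys ++ cartesianProductWith f xs ys)
    ≡⟨ Listₚ.length-++ (List.map (f x) ys) ⟩
  length (List.map (f x) ys) + length (cartesianProductWith f xs ys)
    ≡⟨ cong₂ _+_ (Listₚ.length-map (f x) ys) (length-cartesianProductWith f xs ys) ⟩
  length ys + length xs * length ys
    ∎
  where open ≡-Reasoning

snoc : ∀ {m} → ℕ → Vec ℕ m → Vec ℕ (suc m)
snoc x v = v ∷ʳ x

snoc-injective : ∀ {m} {x y : ℕ} {v w : Vec ℕ m} → snoc x v ≡ snoc y w → x ≡ y × v ≡ w
snoc-injective {v = v} {w} eq = Vecₚ.∷ʳ-injectiveʳ v w eq , Vecₚ.∷ʳ-injectiveˡ v w eq

standardMonomials : (m k : ℕ) → List (Vec ℕ m)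
standardMonomials zero    k = [ [] ]
standardMonomials (suc m) k = cartesianProductWith snoc (upTo (suc k)) (standardMonomials m (suc k))
                           ++ cartesianProductWith snoc (applyUpTo (suc k +_) m) (standardMonomials m k)

standardCount : ℕ → ℕ → ℕ
standardCount zero    k = 1
standardCount (suc m) k = suc k * standardCount m (suc k) + m * standardCount m k

length-standardMonomials : ∀ m k → length (standardMonomials m k) ≡ standardCount m k
length-standardMonomials zero    k = refl
length-standardMonomials (suc m) k = begin
  length (cartesianProductWith snoc max-values max-rest ++ cartesianProductWith snoc min-values min-rest)
    ≡⟨ Listₚ.length-++ (cartesianProductWith snoc max-values max-rest) ⟩
  length (cartesianProductWith snoc max-values max-rest) + length (cartesianProductWith snoc min-values min-rest)
    ≡⟨ cong₂ _+_ (length-cartesianProductWith snoc max-values max-rest)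
                 (length-cartesianProductWith snoc min-values min-rest) ⟩
  length max-values * length max-rest + length min-values * length min-rest
    ≡⟨ cong₂ _+_ (cong₂ _*_ (Listₚ.length-upTo (suc k)) (length-standardMonomials m (suc k)))
                 (cong₂ _*_ (Listₚ.length-applyUpTo (suc k +_) m) (length-standardMonomials m k)) ⟩
  standardCount (suc m) k
    ∎
  where
  open ≡-Reasoning
  max-values = upTo (suc k)
  min-values = applyUpTo (suc k +_) m
  max-rest   = standardMonomials m (suc k)
  min-rest   = standardMonomials m k

standardMonomials-unique : ∀ m k → Unique (standardMonomials m k)
standardMonomials-unique zero    k = All.[] AllPairs.∷ AllPairs.[]
standardMonomials-unique (suc m) k = Unique.++⁺ max-unique min-unique disjoint
  where
  max-part = cartesianProductWith snoc (upTo (suc k)) (standardMonomials m (suc k))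
  min-part = cartesianProductWith snoc (applyUpTo (suc k +_) m) (standardMonomials m k)
  max-unique : Unique max-part
  max-unique = Unique.cartesianProductWith⁺ snoc snoc-injective
    (Unique.upTo⁺ (suc k)) (standardMonomials-unique m (suc k))
  min-unique : Unique min-part
  min-unique = Unique.cartesianProductWith⁺ snoc snoc-injective
    (Unique.applyUpTo⁺₁ (suc k +_) m (λ i<j _ → <⇒≢ (+-monoʳ-< (suc k) i<j))) (standardMonomials-unique m k)
  disjoint : ∀ {c} → ¬ (c ∈ max-part × c ∈ min-part)
  disjoint (c∈max , c∈min)
    with ∈-cartesianProductWith⁻ snoc (upTo (suc k)) _ c∈max
       | ∈-cartesianProductWith⁻ snoc (applyUpTo (suc k +_) m) _ c∈min
  ... | x , _ , x∈ , _ , refl | y , _ , y∈ , _ , eq =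
    <-irrefl (proj₁ (snoc-injective eq)) (<-≤-trans (∈-upTo⁻ x∈) (proj₁ (∈-interval⁻ y∈)))

∈-standardMonomials⁻ : ∀ m k {c} → c ∈ standardMonomials m k → Standard m k (lookup c)
∈-standardMonomials⁻ zero    k _ = tt
∈-standardMonomials⁻ (suc m) k c∈
  with ∈-++⁻ (cartesianProductWith snoc (upTo (suc k)) (standardMonomials m (suc k))) c∈
... | inj₁ c∈max with ∈-cartesianProductWith⁻ snoc (upTo (suc k)) _ c∈max
...   | x , v , x∈ , v∈ , refl = inj₁
  ( subst (_< suc k) (sym (lookup-∷ʳ-fromℕ v x)) (∈-upTo⁻ x∈)
  , standard-cong m (suc k) (sym ∘ lookup-∷ʳ-inject₁ v x) (∈-standardMonomials⁻ m (suc k) v∈))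
∈-standardMonomials⁻ (suc m) k c∈ | inj₂ c∈min
  with ∈-cartesianProductWith⁻ snoc (applyUpTo (suc k +_) m) _ c∈min
...   | x , v , x∈ , v∈ , refl = inj₂
  ( subst (k <_) (sym (lookup-∷ʳ-fromℕ v x)) (proj₁ (∈-interval⁻ x∈))
  , subst (_< suc k + m) (sym (lookup-∷ʳ-fromℕ v x)) (proj₂ (∈-interval⁻ x∈))
  , standard-cong m k (sym ∘ lookup-∷ʳ-inject₁ v x) (∈-standardMonomials⁻ m k v∈))

∈-standardMonomials⁺ : ∀ m k {c} → Standard m k (lookup c) → c ∈ standardMonomials m k
∈-standardMonomials⁺ zero    k {[]} _ = here refl
∈-standardMonomials⁺ (suc m) k {c} c-std with initLast c
... | v , x , refl with c-std
...   | inj₁ (x<1+k , rest) = ∈-++⁺ˡ (∈-cartesianProductWith⁺ snoc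
  (∈-upTo⁺ (subst (_< suc k) (lookup-∷ʳ-fromℕ v x) x<1+k))
  (∈-standardMonomials⁺ m (suc k) (standard-cong m (suc k) (lookup-∷ʳ-inject₁ v x) rest)))
...   | inj₂ (k<x , x<1+k+m , rest) =
  ∈-++⁺ʳ (cartesianProductWith snoc (upTo (suc k)) (standardMonomials m (suc k))) (∈-cartesianProductWith⁺ snoc
    (∈-interval⁺ (subst (k <_) (lookup-∷ʳ-fromℕ v x) k<x)
                 (subst (_< suc k + m) (lookup-∷ʳ-fromℕ v x) x<1+k+m))
    (∈-standardMonomials⁺ m k (standard-cong m k (lookup-∷ʳ-inject₁ v x) rest)))

sumUpTo : ℕ → (ℕ → ℕ) → ℕ
sumUpTo N f = ∑[ r < N ] f (toℕ r)

sumUpTo-cong : ∀ N (f g : ℕ → ℕ) → (∀ r → f r ≡ g r) → sumUpTo N f ≡ sumUpTo N g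
sumUpTo-cong N f g f≗g = sum-cong-≗ {N} (f≗g ∘ toℕ)

listSum-map-applyUpTo : ∀ (h f : ℕ → ℕ) n → ListAction.sum (List.map h (applyUpTo f n)) ≡ sumUpTo n (h ∘ f)
listSum-map-applyUpTo h f zero    = refl
listSum-map-applyUpTo h f (suc n) = cong (h (f 0) +_) (listSum-map-applyUpTo h (f ∘ suc) n)

-- Both sides agree because n · s(n, 0) = 0.
*-sumUpTo-stirling-tail : ∀ n N (h : ℕ → ℕ) →
                          n * sumUpTo N (λ r → stirling n (suc r) * h (suc r))
                          ≡ n * sumUpTo (suc N) (λ r → stirling n r * h r)
*-sumUpTo-stirling-tail zero    N h = refl
*-sumUpTo-stirling-tail (suc n) N h = refl

sumUpTo-stirling-suc : ∀ n N (h : ℕ → ℕ) →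
                       sumUpTo (suc N) (λ r → stirling (suc n) r * h r)
                       ≡ sumUpTo N (λ r → stirling n r * h (suc r)) + n * sumUpTo (suc N) (λ r → stirling n r * h r)
sumUpTo-stirling-suc n N h = begin
  sumUpTo N (λ r → (n * s (suc r) + s r) * h (suc r))
    ≡⟨ sumUpTo-cong N _ _ (λ r → split n (s (suc r)) (s r) (h (suc r))) ⟩
  sumUpTo N (λ r → s r * h (suc r) + n * (s (suc r) * h (suc r)))
    ≡⟨ ∑-distrib-+ {N} (λ r → s (toℕ r) * h (suc (toℕ r)))
                       (λ r → n * (s (suc (toℕ r)) * h (suc (toℕ r)))) ⟩
  sumUpTo N (λ r → s r * h (suc r)) + sumUpTo N (λ r → n * (s (suc r) * h (suc r)))
    ≡⟨ cong (tail-sum +_) (*-distribˡ-sum {N} n (λ r → s (suc (toℕ r)) * h (suc (toℕ r)))) ⟨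
  sumUpTo N (λ r → s r * h (suc r)) + n * sumUpTo N (λ r → s (suc r) * h (suc r))
    ≡⟨ cong (tail-sum +_) (*-sumUpTo-stirling-tail n N h) ⟩
  sumUpTo N (λ r → s r * h (suc r)) + n * sumUpTo (suc N) (λ r → s r * h r)
    ∎
  where
  open ≡-Reasoning
  s = stirling n
  tail-sum = sumUpTo N (λ r → s r * h (suc r))
  split : ∀ n a b c → (n * a + b) * c ≡ b * c + n * (a * c)
  split = solve-∀

-- The range N is free (any N > n will do, as s(n, r) = 0 for r > n) so that the induction
-- hypothesis can be used both at N and at N + 1.
standardCount-factorial : ∀ n k N → n < N →
                          standardCount n k * k ! ≡ sumUpTo N (λ r → stirling n r * (k + r) !)
standardCount-factorial zero    k (suc N) _ = begin
  1 * k !                                          ≡⟨ cong (λ t → 1 * t !) (+-identityʳ k) ⟨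
  1 * (k + 0) !                                    ≡⟨ +-identityʳ _ ⟨
  1 * (k + 0) ! + 0                                ≡⟨ cong (1 * (k + 0) ! +_) (sum-replicate-zero N) ⟨
  sumUpTo (suc N) (λ r → stirling 0 r * (k + r) !) ∎
  where open ≡-Reasoning
standardCount-factorial (suc n) k (suc N) (s≤s n<N) = begin
  (suc k * standardCount n (suc k) + n * standardCount n k) * k !
    ≡⟨ rearrange k n (standardCount n (suc k)) (standardCount n k) (k !) ⟩
  standardCount n (suc k) * suc k ! + n * (standardCount n k * k !)
    ≡⟨ cong₂ (λ a b → a + n * b) (standardCount-factorial n (suc k) N n<N)
                                 (standardCount-factorial n k (suc N) (m<n⇒m<1+n n<N)) ⟩
  sumUpTo N (λ r → stirling n r * (suc k + r) !) + n * sumUpTo (suc N) (λ r → stirling n r * (k + r) !)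
    ≡⟨ cong (_+ n * sumUpTo (suc N) (λ r → stirling n r * (k + r) !))
            (sumUpTo-cong N _ _ (λ r → cong (λ t → stirling n r * t !) (sym (+-suc k r)))) ⟩
  sumUpTo N (λ r → stirling n r * (k + suc r) !) + n * sumUpTo (suc N) (λ r → stirling n r * (k + r) !)
    ≡⟨ sumUpTo-stirling-suc n N (λ r → (k + r) !) ⟨
  sumUpTo (suc N) (λ r → stirling (suc n) r * (k + r) !)
    ∎
  where
  open ≡-Reasoning
  rearrange : ∀ k n a b f → (suc k * a + n * b) * f ≡ a * (suc k * f) + n * (b * f)
  rearrange = solve-∀

standardCount≡rhs : ∀ n → 1 ≤ n → standardCount n 0 ≡ rhs n
standardCount≡rhs (suc n) _ = begin
  standardCount (suc n) 0
    ≡⟨ *-identityʳ _ ⟨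
  standardCount (suc n) 0 * 0 !
    ≡⟨ standardCount-factorial (suc n) 0 (suc (suc n)) ≤-refl ⟩
  sumUpTo (suc n) (λ r → stirling (suc n) (suc r) * suc r !)
    ≡⟨ sumUpTo-cong (suc n) _ _ (λ r → *-comm (stirling (suc n) (suc r)) (suc r !)) ⟩
  sumUpTo (suc n) (λ r → suc r ! * stirling (suc n) (suc r))
    ≡⟨ listSum-map-applyUpTo _ id (suc n) ⟨
  rhs (suc n)
    ∎
  where open ≡-Reasoning

generator : ∀ {n} → (Fin n → Fin n) → Vec ℕ n
generator σ = tabulate (λ i → suc (toℕ (σ i)))

generator-minimal : ∀ {n} {σ : Fin n → Fin n} → InW n σ → MinGen (GenW n) (generator σ)
generator-minimal {n} {σ} σ∈W@(σ-inj , _) = (σ , σ∈W , refl) , minimal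
  where
  minimal : ∀ b → GenW n b → b ∣ₘ generator σ → b ≡ generator σ
  minimal _ (τ , (τ-inj , _) , refl) τ∣σ =
    Vecₚ.tabulate-cong (cong (suc ∘ toℕ) ∘ injective-≤⇒≗ τ-inj σ-inj τ≤σ)
    where
    τ≤σ : ∀ i → τ i ≤ᶠ σ i
    τ≤σ i = s≤s⁻¹ (subst₂ _≤_ (Vecₚ.lookup∘tabulate _ i) (Vecₚ.lookup∘tabulate _ i)
                              (Pointwise.lookup τ∣σ i))

lookup-dual-exponent : ∀ {n} (σ : Fin n → Fin n) i →
                       lookup (replicate n n ∖ₑ generator σ) i ≡ n ∸ toℕ (σ i)
lookup-dual-exponent {n} σ i = trans (Vecₚ.lookup-zipWith minusEntry i (replicate n n) (generator σ))
  (cong₂ minusEntry (Vecₚ.lookup-replicate i n) (Vecₚ.lookup∘tabulate (λ i → suc (toℕ (σ i))) i))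

inMd-dual⇔ : ∀ {n} (σ : Fin n → Fin n) c →
             InMd (replicate n n ∖ₑ generator σ) c ⇔ (∃ λ i → n ≤ lookup c i + toℕ (σ i))
inMd-dual⇔ {n} σ c = mk⇔ to from
  where
  σ<n : ∀ i → toℕ (σ i) < n
  σ<n = Finₚ.toℕ<n ∘ σ
  to : InMd (replicate n n ∖ₑ generator σ) c → ∃ λ i → n ≤ lookup c i + toℕ (σ i)
  to (i , _ , d≤c) = i , subst (_≤ lookup c i + toℕ (σ i)) (m∸n+n≡m (<⇒≤ (σ<n i)))
    (+-monoˡ-≤ (toℕ (σ i)) (subst (_≤ lookup c i) (lookup-dual-exponent σ i) d≤c))
  from : (∃ λ i → n ≤ lookup c i + toℕ (σ i)) → InMd (replicate n n ∖ₑ generator σ) c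
  from (i , n≤c+σ) = i
    , subst (1 ≤_) (sym (lookup-dual-exponent σ i)) (m<n⇒0<n∸m (σ<n i))
    , subst (_≤ lookup c i) (sym (lookup-dual-exponent σ i))
        (subst (n ∸ toℕ (σ i) ≤_) (m+n∸n≡m (lookup c i) (toℕ (σ i)))
               (∸-monoˡ-≤ (toℕ (σ i)) n≤c+σ))

inAlexDual⇔ : ∀ n c → InAlexDual (replicate n n) (GenW n) c
                      ⇔ (∀ σ → InW n σ → ∃ λ i → n ≤ lookup c i + toℕ (σ i))
inAlexDual⇔ n c = mk⇔
  (λ c∈dual σ σ∈W → Equivalence.to (inMd-dual⇔ σ c) (c∈dual (generator σ) (generator-minimal σ∈W)))
  (λ { hits _ ((σ , σ∈W , refl) , _) → Equivalence.from (inMd-dual⇔ σ c) (hits σ σ∈W) })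

standard⇔∉dual : ∀ n c → Standard n 0 (lookup c) ⇔ (¬ InAlexDual (replicate n n) (GenW n) c)
standard⇔∉dual n c = mk⇔ to from
  where
  to : Standard n 0 (lookup c) → ¬ InAlexDual (replicate n n) (GenW n) c
  to std c∈dual with Equivalence.to (standard⇔below-W n (lookup c)) std
  ... | σ , σ∈W , below with Equivalence.to (inAlexDual⇔ n c) c∈dual σ σ∈W
  ...   | i , n≤c+σ = <⇒≱ (below i) n≤c+σ
  ¬standard⇒reaches : ¬ Standard n 0 (lookup c) →
                      ∀ σ → InW n σ → ∃ λ i → n ≤ lookup c i + toℕ (σ i)
  ¬standard⇒reaches ¬std σ σ∈W
    with Finₚ.¬∀⟶∃¬ n _ (λ i → lookup c i + toℕ (σ i) <? n)
                       (λ below → ¬std (Equivalence.from (standard⇔below-W n (lookup c)) (σ , σ∈W , below)))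
  ... | i , c+σ≮n = i , ≮⇒≥ c+σ≮n
  from : ¬ InAlexDual (replicate n n) (GenW n) c → Standard n 0 (lookup c)
  from c∉dual = decidable-stable (standard? n 0 (lookup c))
    (c∉dual ∘ Equivalence.from (inAlexDual⇔ n c) ∘ ¬standard⇒reaches)

theorem1 : (n : ℕ) → 1 ≤ n → QuotDim (InAlexDual (replicate n n) (GenW n)) (rhs n)
theorem1 n 1≤n =
  standardMonomials n 0 ,
  standardMonomials-unique n 0 ,
  trans (length-standardMonomials n 0) (standardCount≡rhs n 1≤n) ,
  λ c → mk⇔ (Equivalence.to (standard⇔∉dual n c) ∘ ∈-standardMonomials⁻ n 0)
            (∈-standardMonomials⁺ n 0 ∘ Equivalence.from (standard⇔∉dual n c))
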